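{- Let $p\geq 5$ be prime and let $\mathcal A_p$ be the set of non-ranks with parent prime $p$. Let $L(p)=\prod_{5\leq p'\leq p}p'$ (product over primes). Then the number $G(p)$ of elements of $\mathcal A_p$ per period $L(p)$ (that is, $L(p)$ times the natural density of $\mathcal A_p$ in the positive integers) equals $G(p)=\prod_{5\leq p'<p}(p'-2)$ (product over primes $p'$); equivalently, $\mathcal A_p$ has natural density $q(p)=\frac{G(p)}{L(p)}=\frac1p\prod_{5\leq p'<p}\frac{p'-2}{p'}$.
   Context: For real $x$, $N(x)$ is the integer nearest to $x$. For a prime $q\geq 5$, the non-ranks of $q$ are the integers $(2n+1)q+4N(q/6)$ with $n\geq 0$ and $(2n+1)q-4N(q/6)$ with $n\geq 1$. The parent prime of an integer that is a non-rank of some prime $\geq 5$ is the smallest prime $q\geq 5$ of which it is a non-rank. -}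

module Defs where

open import Data.Nat using (ℕ; zero; suc; _+_; _*_; _∸_; _≤_; _<_; _/_; ∣_-_∣; z≤n; s≤s)
open import Data.Nat.Properties
  using (_≟_; _≤?_; anyUpTo?; allUpTo?; *-zeroʳ; m≤m*n; m≤m+n; ≤-trans; ≤-refl; m≤n⇒m≤1+n)
open import Data.Nat.Primality using (Prime; prime?)
open import Data.Product using (Σ; ∃; _×_; _,_)
open import Data.Sum using (_⊎_; inj₁; inj₂)
open import Data.Empty using (⊥)
open import Relation.Nullary using (¬_; Dec; yes; no; does)
open import Relation.Nullary.Decidable using (_×-dec_; _⊎-dec_; map′; ¬?)
open import Relation.Binary.PropositionalEquality using (_≡_; refl; subst; sym; trans)
open import Data.Bool using (if_then_else_)

-- N(q/6): the integer nearest to q/6, i.e. ⌊q/6 + 1/2⌋ = ⌊(q+3)/6⌋.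
-- (A tie would need q ≡ 3 mod 6, impossible for primes q ≥ 5.)

nearestSixth : ℕ → ℕ
nearestSixth q = (q + 3) / 6

shift : ℕ → ℕ
shift q = 4 * nearestSixth q

-- m is a non-rank of q:
--   m = (2n+1)q + 4N(q/6) for some n ≥ 0, or
--   m = (2n+1)q - 4N(q/6) for some n ≥ 1 (written additively, m ∈ ℕ).
-- For primes q ≥ 5 all non-ranks are positive, so ℕ loses nothing.

NonRank : ℕ → ℕ → Set
NonRank q m =
  (Σ ℕ λ n → m ≡ (2 * n + 1) * q + shift q)
  ⊎ (Σ ℕ λ n → 1 ≤ n × m + shift q ≡ (2 * n + 1) * q)

HasParent : ℕ → ℕ → Set
HasParent p m =
  NonRank p m × (∀ q → Prime q → 5 ≤ q → q < p → ¬ NonRank q m)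

private
  n≤2n+1 : ∀ n → n ≤ 2 * n + 1
  n≤2n+1 n = ≤-trans (m≤m+n n (n + 0)) (m≤m+n (n + (n + 0)) 1)

  bound : ∀ n q' → n ≤ (2 * n + 1) * suc q'
  bound n q' = ≤-trans (n≤2n+1 n) (m≤m*n (2 * n + 1) (suc q'))

  from1 : ∀ q m → (Σ ℕ λ n → m ≡ (2 * n + 1) * q + shift q)
        → ∃ λ n → n < suc m × m ≡ (2 * n + 1) * q + shift q
  from1 zero m (n , e) = 0 , s≤s z≤n , subst (λ z → m ≡ z + shift 0) (*-zeroʳ (2 * n + 1)) e
  from1 (suc q') m (n , e) = n , s≤s (≤-trans (bound n q')
                     (subst ((2 * n + 1) * suc q' ≤_) (sym e) (m≤m+n _ _))) , e

  case1? : ∀ q m → Dec (Σ ℕ λ n → m ≡ (2 * n + 1) * q + shift q)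
  case1? q m = map′ (λ { (n , _ , e) → n , e }) (from1 q m)
    (anyUpTo? (λ n → m ≟ (2 * n + 1) * q + shift q) (suc m))

  from2 : ∀ q m → (Σ ℕ λ n → 1 ≤ n × m + shift q ≡ (2 * n + 1) * q)
        → ∃ λ n → n < suc (suc (m + shift q)) × (1 ≤ n × m + shift q ≡ (2 * n + 1) * q)
  from2 zero m (n , 1≤n , e) = 1 , s≤s (s≤s z≤n) , s≤s z≤n ,
                 trans e (trans (*-zeroʳ (2 * n + 1)) (sym (*-zeroʳ 3)))
  from2 (suc q') m (n , 1≤n , e) = n , m≤n⇒m≤1+n (s≤s (subst (n ≤_) (sym e) (bound n q'))) , 1≤n , e

  case2? : ∀ q m → Dec (Σ ℕ λ n → 1 ≤ n × m + shift q ≡ (2 * n + 1) * q)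
  case2? q m = map′ (λ { (n , _ , p) → n , p }) (from2 q m)
    (anyUpTo? (λ n → (1 ≤? n) ×-dec (m + shift q ≟ (2 * n + 1) * q)) (suc (suc (m + shift q))))

nonRank? : ∀ q m → Dec (NonRank q m)
nonRank? q m = case1? q m ⊎-dec case2? q m

hasParent? : ∀ p m → Dec (HasParent p m)
hasParent? p m = nonRank? p m ×-dec map′ to from
  (allUpTo? (λ q → ¬? (prime? q ×-dec (5 ≤? q) ×-dec nonRank? q m)) p)
  where
  to : _ → _
  to f q pq 5≤q q<p nr = f q<p (pq , 5≤q , nr)
  from : _ → _
  from g {q} q<p (pq , 5≤q , nr) = g q pq 5≤q q<p nr

countParent : ℕ → ℕ → ℕ
countParent p zero = zero
countParent p (suc n) =
  if does (hasParent? p (suc n)) then suc (countParent p n) else countParent p n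

primeProd : (ℕ → ℕ) → ℕ → ℕ
primeProd f zero = 1
primeProd f (suc k) =
  (if does (prime? (suc k) ×-dec (5 ≤? suc k)) then f (suc k) else 1) * primeProd f k

L : ℕ → ℕ
L p = primeProd (λ x → x) p

G : ℕ → ℕ
G p = primeProd (λ x → x ∸ 2) (p ∸ 1)

-- Natural density: a set with counting function count (count n =
-- #(A ∩ [1,n])) has natural density a/b (b > 0) iff count n / n → a/b,
-- i.e. for every ε = 1/d (d ≥ 1) there is N with
-- |count n / n - a/b| < 1/d for all n ≥ N, cleared of denominators:
--   d * |b * count n - a * n| < b * n.

HasNaturalDensity : (count : ℕ → ℕ) → (a b : ℕ) → Set
HasNaturalDensity count a b =
  ∀ d → 1 ≤ d → ∃ λ N → ∀ n → N ≤ n → d * ∣ b * count n - a * n ∣ < b * n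

{-# OPTIONS --safe #-}
-- For m ≥ p, the non-ranks of a prime p ≥ 5 are exactly the odd m in the two residue classes
-- ±4N(p/6) mod p, which are distinct and nonzero. So an m ≥ p has parent p iff it is odd, lies in
-- one of the two classes of p and in none of the two classes of any prime 5 ≤ q < p. This condition
-- has period 2 L(p), and by the Chinese remainder theorem a period contains 2 ∏ (q - 2) = 2 G(p)
-- such m: each prime q < p keeps q - 2 of its residues and p keeps 2. The finitely many m < p only
-- change the counting function by a bounded amount, so the density is G(p)/L(p).
module Submission where

open import Defs
open import Data.Bool using (Bool; true; false; _∧_; _∨_; not; T; if_then_else_)
open import Data.Bool.Properties using (T-∧; T-∨)
open import Data.Empty using (⊥-elim)
open import Data.Nat
open import Data.Nat.DivMod
open import Data.Nat.Divisibility
open import Data.Nat.Primality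
open import Data.Nat.Properties
open import Data.Nat.Tactic.RingSolver using (solve-∀)
open import Data.Product using (_×_; _,_; ∃)
open import Data.Sum using (_⊎_; inj₁; inj₂)
open import Function using (_∘_; Equivalence; mk⇔)
open import Relation.Binary.PropositionalEquality
open import Relation.Nullary using (¬_; does; yes; no)
open import Relation.Nullary.Decidable using (_×-dec_; toWitness; fromWitness; isYes≗does; does-⇔; T?)

𝟙 : Bool → ℕ
𝟙 true = 1
𝟙 false = 0

𝟙≤1 : ∀ b → 𝟙 b ≤ 1
𝟙≤1 true = ≤-refl
𝟙≤1 false = z≤n

𝟙-∧ : ∀ x y → 𝟙 (x ∧ y) ≡ 𝟙 x * 𝟙 y
𝟙-∧ true y = sym (+-identityʳ (𝟙 y))
𝟙-∧ false y = refl

𝟙-∨ : ∀ x y → ¬ (T x × T y) → 𝟙 (x ∨ y) ≡ 𝟙 x + 𝟙 y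
𝟙-∨ true true ¬both = ⊥-elim (¬both _)
𝟙-∨ true false _ = refl
𝟙-∨ false y _ = refl

𝟙-T : ∀ {b} → T b → 𝟙 b ≡ 1
𝟙-T {true} _ = refl

𝟙-¬T : ∀ {b} → ¬ T b → 𝟙 b ≡ 0
𝟙-¬T {true} ¬b = ⊥-elim (¬b _)
𝟙-¬T {false} _ = refl

𝟙-≡ᵇ : ∀ {x t} → x ≡ t → 𝟙 (x ≡ᵇ t) ≡ 1
𝟙-≡ᵇ {x} {t} x≡t = 𝟙-T (≡⇒≡ᵇ x t x≡t)

𝟙-≢ᵇ : ∀ {x t} → x ≢ t → 𝟙 (x ≡ᵇ t) ≡ 0
𝟙-≢ᵇ {x} {t} x≢t = 𝟙-¬T (x≢t ∘ ≡ᵇ⇒≡ x t)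

sumBelow : ℕ → (ℕ → ℕ) → ℕ
sumBelow zero f = 0
sumBelow (suc n) f = sumBelow n f + f n

syntax sumBelow n (λ i → e) = ∑[ i < n ] e

module _ {f g : ℕ → ℕ} where

  sum-cong : ∀ n → (∀ i → i < n → f i ≡ g i) → ∑[ i < n ] f i ≡ ∑[ i < n ] g i
  sum-cong zero eq = refl
  sum-cong (suc n) eq = cong₂ _+_ (sum-cong n λ i i<n → eq i (m≤n⇒m≤1+n i<n)) (eq n ≤-refl)

  sum-+ : ∀ n → ∑[ i < n ] (f i + g i) ≡ ∑[ i < n ] f i + ∑[ i < n ] g i
  sum-+ zero = refl
  sum-+ (suc n) = trans (cong (_+ (f n + g n)) (sum-+ n)) (interchange (∑[ i < n ] f i) (∑[ i < n ] g i) (f n) (g n))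
    where
    interchange : ∀ a b c d → (a + b) + (c + d) ≡ (a + c) + (b + d)
    interchange = solve-∀

sum-const : ∀ n c → ∑[ i < n ] c ≡ n * c
sum-const zero c = refl
sum-const (suc n) c = trans (cong (_+ c) (sum-const n c)) (+-comm (n * c) c)

sum-zero : ∀ (f : ℕ → ℕ) n → (∀ i → i < n → f i ≡ 0) → ∑[ i < n ] f i ≡ 0
sum-zero f n f≡0 = trans (sum-cong n f≡0) (trans (sum-const n 0) (*-zeroʳ n))

sum-*ʳ : ∀ (f : ℕ → ℕ) c n → ∑[ i < n ] (f i * c) ≡ ∑[ i < n ] f i * c
sum-*ʳ f c zero = refl
sum-*ʳ f c (suc n) = trans (cong (_+ f n * c) (sum-*ʳ f c n)) (sym (*-distribʳ-+ c (∑[ i < n ] f i) (f n)))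

sum-*ˡ : ∀ (f : ℕ → ℕ) c n → ∑[ i < n ] (c * f i) ≡ c * ∑[ i < n ] f i
sum-*ˡ f c zero = sym (*-zeroʳ c)
sum-*ˡ f c (suc n) = trans (cong (_+ c * f n) (sum-*ˡ f c n)) (sym (*-distribˡ-+ c (∑[ i < n ] f i) (f n)))

sum-swap : ∀ (f : ℕ → ℕ → ℕ) m n → ∑[ i < m ] ∑[ j < n ] f i j ≡ ∑[ j < n ] ∑[ i < m ] f i j
sum-swap f zero n = sym (trans (sum-const n 0) (*-zeroʳ n))
sum-swap f (suc m) n = begin
  ∑[ i < m ] ∑[ j < n ] f i j + ∑[ j < n ] f m j ≡⟨ cong (_+ ∑[ j < n ] f m j) (sum-swap f m n) ⟩
  ∑[ j < n ] ∑[ i < m ] f i j + ∑[ j < n ] f m j ≡⟨ sum-+ n ⟨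
  ∑[ j < n ] ∑[ i < suc m ] f i j                ∎
  where open ≡-Reasoning

sum-split : ∀ (f : ℕ → ℕ) m n → ∑[ i < m + n ] f i ≡ ∑[ i < m ] f i + ∑[ i < n ] f (m + i)
sum-split f m zero rewrite +-identityʳ m = sym (+-identityʳ _)
sum-split f m (suc n) rewrite +-suc m n =
  trans (cong (_+ f (m + n)) (sum-split f m n)) (+-assoc (∑[ i < m ] f i) _ _)

sum-blocks : ∀ (f : ℕ → ℕ) q M → ∑[ i < q * M ] f i ≡ ∑[ j < q ] ∑[ a < M ] f (a + j * M)
sum-blocks f zero M = refl
sum-blocks f (suc q) M = begin
  ∑[ i < M + q * M ] f i                          ≡⟨ cong (λ k → ∑[ i < k ] f i) (+-comm M (q * M)) ⟩
  ∑[ i < q * M + M ] f i                          ≡⟨ sum-split f (q * M) M ⟩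
  ∑[ i < q * M ] f i + ∑[ a < M ] f (q * M + a)   ≡⟨ cong₂ _+_ (sum-blocks f q M)
                                                       (sum-cong M λ a _ → cong f (+-comm (q * M) a)) ⟩
  ∑[ j < q ] ∑[ a < M ] f (a + j * M) + ∑[ a < M ] f (a + q * M) ∎
  where open ≡-Reasoning

sum-≤ : ∀ (f : ℕ → ℕ) n → (∀ i → f i ≤ 1) → ∑[ i < n ] f i ≤ n
sum-≤ f zero _ = z≤n
sum-≤ f (suc n) f≤1 = subst (∑[ i < suc n ] f i ≤_) (+-comm n 1) (+-mono-≤ (sum-≤ f n f≤1) (f≤1 n))

Periodic : ∀ {A : Set} → ℕ → (ℕ → A) → Set
Periodic M f = ∀ a → f (a + M) ≡ f a

periodic-multiple : ∀ {A : Set} {M} {f : ℕ → A} → Periodic M f → ∀ a j → f (a + j * M) ≡ f a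
periodic-multiple {M = M} {f} per a zero = cong f (+-identityʳ a)
periodic-multiple {M = M} {f} per a (suc j) =
  trans (cong f (regroup a M (j * M))) (trans (per (a + j * M)) (periodic-multiple per a j))
  where
  regroup : ∀ a b c → a + (b + c) ≡ a + c + b
  regroup = solve-∀

sum-not : ∀ (g : ℕ → Bool) n → ∑[ i < n ] 𝟙 (not (g i)) ≡ n ∸ ∑[ i < n ] 𝟙 (g i)
sum-not g n = sym (trans (cong (_∸ ∑[ i < n ] 𝟙 (g i)) partition) (m+n∸n≡m _ (∑[ i < n ] 𝟙 (g i))))
  where
  open ≡-Reasoning
  𝟙-not : ∀ b → 𝟙 (not b) + 𝟙 b ≡ 1
  𝟙-not true = refl
  𝟙-not false = refl
  partition : n ≡ ∑[ i < n ] 𝟙 (not (g i)) + ∑[ i < n ] 𝟙 (g i)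
  partition = begin
    n                                                   ≡⟨ trans (sum-const n 1) (*-identityʳ n) ⟨
    ∑[ i < n ] 1                                        ≡⟨ sum-cong n (λ i _ → 𝟙-not (g i)) ⟨
    ∑[ i < n ] (𝟙 (not (g i)) + 𝟙 (g i))                ≡⟨ sum-+ n ⟩
    ∑[ i < n ] 𝟙 (not (g i)) + ∑[ i < n ] 𝟙 (g i)      ∎

sum-∧-periodic : ∀ (g h : ℕ → Bool) q M c → Periodic M h
  → (∀ a → ∑[ j < q ] 𝟙 (g (a + j * M)) ≡ c)
  → ∑[ i < q * M ] 𝟙 (g i ∧ h i) ≡ c * ∑[ i < M ] 𝟙 (h i)
sum-∧-periodic g h q M c per count-g = begin
  ∑[ i < q * M ] 𝟙 (g i ∧ h i)                           ≡⟨ sum-blocks _ q M ⟩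
  ∑[ j < q ] ∑[ a < M ] 𝟙 (g (a + j * M) ∧ h (a + j * M)) ≡⟨ sum-swap _ q M ⟩
  ∑[ a < M ] ∑[ j < q ] 𝟙 (g (a + j * M) ∧ h (a + j * M)) ≡⟨ sum-cong M (λ a _ → column a) ⟩
  ∑[ a < M ] (c * 𝟙 (h a))                               ≡⟨ sum-*ˡ _ c M ⟩
  c * ∑[ i < M ] 𝟙 (h i)                                 ∎
  where
  open ≡-Reasoning
  column : ∀ a → ∑[ j < q ] 𝟙 (g (a + j * M) ∧ h (a + j * M)) ≡ c * 𝟙 (h a)
  column a = begin
    ∑[ j < q ] 𝟙 (g (a + j * M) ∧ h (a + j * M)) ≡⟨ sum-cong q (λ j _ → factor j) ⟩
    ∑[ j < q ] (𝟙 (g (a + j * M)) * 𝟙 (h a))     ≡⟨ sum-*ʳ _ (𝟙 (h a)) q ⟩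
    ∑[ j < q ] 𝟙 (g (a + j * M)) * 𝟙 (h a)       ≡⟨ cong (_* 𝟙 (h a)) (count-g a) ⟩
    c * 𝟙 (h a)                                  ∎
    where
    factor : ∀ j → 𝟙 (g (a + j * M) ∧ h (a + j * M)) ≡ 𝟙 (g (a + j * M)) * 𝟙 (h a)
    factor j = trans (𝟙-∧ (g (a + j * M)) (h (a + j * M)))
                     (cong (λ b → 𝟙 (g (a + j * M)) * 𝟙 b) (periodic-multiple per a j))

sum-periodic : ∀ {f : ℕ → ℕ} {P} → Periodic P f → ∀ j t
             → ∑[ i < j * P + t ] f i ≡ j * ∑[ i < P ] f i + ∑[ i < t ] f i
sum-periodic {f} {P} per j t = begin
  ∑[ i < j * P + t ] f i                                ≡⟨ sum-split f (j * P) t ⟩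
  ∑[ i < j * P ] f i + ∑[ i < t ] f (j * P + i)         ≡⟨ cong₂ _+_ (sum-blocks f j P)
                                                                      (sum-cong t λ i _ → shifted i) ⟩
  ∑[ j′ < j ] ∑[ a < P ] f (a + j′ * P) + ∑[ i < t ] f i ≡⟨ cong (_+ ∑[ i < t ] f i)
                                                              (trans (sum-cong j λ j′ _ → block j′)
                                                                     (sum-const j (∑[ i < P ] f i))) ⟩
  j * ∑[ i < P ] f i + ∑[ i < t ] f i                   ∎
  where
  open ≡-Reasoning
  shifted : ∀ i → f (j * P + i) ≡ f i
  shifted i = trans (cong f (+-comm (j * P) i)) (periodic-multiple per i j)
  block : ∀ j′ → ∑[ a < P ] f (a + j′ * P) ≡ ∑[ a < P ] f a
  block j′ = sum-cong P λ a _ → periodic-multiple per a j′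

-- Writing n = j P + t with t < P, the full periods cancel and only the remainder contributes.
periodic-sum-error : ∀ {f : ℕ → ℕ} P .{{_ : NonZero P}} → Periodic P f → (∀ i → f i ≤ 1)
                   → ∀ n → ∣ P * ∑[ i < n ] f i - ∑[ i < P ] f i * n ∣ ≤ P * P
periodic-sum-error {f} P per f≤1 n = begin
  ∣ P * ∑[ i < n ] f i - S * n ∣
    ≡⟨ cong (λ m → ∣ P * ∑[ i < m ] f i - S * m ∣) n≡ ⟩
  ∣ P * ∑[ i < j * P + t ] f i - S * (j * P + t) ∣
    ≡⟨ cong (λ x → ∣ P * x - S * (j * P + t) ∣) (sum-periodic per j t) ⟩
  ∣ P * (j * S + ∑[ i < t ] f i) - S * (j * P + t) ∣
    ≡⟨ cong₂ ∣_-_∣ (*-distribˡ-+ P (j * S) _)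
                   (trans (*-distribˡ-+ S (j * P) t) (cong (_+ S * t) (sym (swap P S j)))) ⟩
  ∣ P * (j * S) + P * ∑[ i < t ] f i - P * (j * S) + S * t ∣
    ≡⟨ ∣m+n-m+o∣≡∣n-o∣ (P * (j * S)) _ _ ⟩
  ∣ P * ∑[ i < t ] f i - S * t ∣
    ≤⟨ ∣m-n∣≤m⊔n (P * ∑[ i < t ] f i) (S * t) ⟩
  P * ∑[ i < t ] f i ⊔ S * t
    ≤⟨ ⊔-lub (*-monoʳ-≤ P (≤-trans (sum-≤ f t f≤1) t≤P)) (*-mono-≤ (sum-≤ f P f≤1) t≤P) ⟩
  P * P
    ∎
  where
  open ≤-Reasoning
  S = ∑[ i < P ] f i
  t = n % P
  j = n / P
  t≤P = <⇒≤ (m%n<n n P)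
  n≡ : n ≡ j * P + t
  n≡ = trans (m≡m%n+[m/n]*n n P) (+-comm t (j * P))
  swap : ∀ P S j → P * (j * S) ≡ S * (j * P)
  swap = solve-∀

sum-eventually-equal : ∀ (f g : ℕ → ℕ) K → (∀ i → f i ≤ 1) → (∀ i → g i ≤ 1)
                     → (∀ i → K ≤ i → f i ≡ g i) → ∀ n → ∣ ∑[ i < n ] f i - ∑[ i < n ] g i ∣ ≤ K
sum-eventually-equal f g K f≤1 g≤1 f≡g zero = z≤n
sum-eventually-equal f g K f≤1 g≤1 f≡g (suc n) with K ≤? n
... | yes K≤n = begin
  ∣ ∑[ i < n ] f i + f n - ∑[ i < n ] g i + g n ∣ ≡⟨ cong (λ y → ∣ ∑[ i < n ] f i + f n - ∑[ i < n ] g i + y ∣)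
                                                          (f≡g n K≤n) ⟨
  ∣ ∑[ i < n ] f i + f n - ∑[ i < n ] g i + f n ∣ ≡⟨ cong₂ ∣_-_∣ (+-comm _ (f n)) (+-comm _ (f n)) ⟩
  ∣ f n + ∑[ i < n ] f i - f n + ∑[ i < n ] g i ∣ ≡⟨ ∣m+n-m+o∣≡∣n-o∣ (f n) _ _ ⟩
  ∣ ∑[ i < n ] f i - ∑[ i < n ] g i ∣             ≤⟨ sum-eventually-equal f g K f≤1 g≤1 f≡g n ⟩
  K                                               ∎
  where open ≤-Reasoning
... | no K≰n = ≤-trans (∣m-n∣≤m⊔n (∑[ i < suc n ] f i) (∑[ i < suc n ] g i))
                      (⊔-lub (≤-trans (sum-≤ f (suc n) f≤1) (≰⇒> K≰n))
                             (≤-trans (sum-≤ g (suc n) g≤1) (≰⇒> K≰n)))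

bounded-error⇒density : ∀ count a b K → 0 < b → (∀ n → ∣ b * count n - a * n ∣ ≤ K)
                      → HasNaturalDensity count a b
bounded-error⇒density count a b K 0<b error d _ = suc (d * K) , λ n N≤n → begin-strict
  d * ∣ b * count n - a * n ∣ ≤⟨ *-monoʳ-≤ d (error n) ⟩
  d * K                       <⟨ N≤n ⟩
  n                           ≤⟨ m≤n*m n b ⟩
  b * n                       ∎
  where
  open ≤-Reasoning
  instance _ = >-nonZero 0<b

sum-≡ᵇ-absent : ∀ x n → n ≤ x → ∑[ t < n ] 𝟙 (x ≡ᵇ t) ≡ 0
sum-≡ᵇ-absent x n n≤x =
  sum-zero (λ t → 𝟙 (x ≡ᵇ t)) n λ t t<n → 𝟙-≢ᵇ {x} {t} λ { refl → <⇒≱ t<n n≤x }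

sum-≡ᵇ-present : ∀ x n → x < n → ∑[ t < n ] 𝟙 (x ≡ᵇ t) ≡ 1
sum-≡ᵇ-present x (suc n) x<1+n with x ≟ n
... | yes refl = cong₂ _+_ (sum-≡ᵇ-absent x x ≤-refl) (𝟙-≡ᵇ {x} refl)
... | no x≢n = cong₂ _+_ (sum-≡ᵇ-present x n (≤∧≢⇒< (s≤s⁻¹ x<1+n) x≢n)) (𝟙-≢ᵇ x≢n)

module _ (r : ℕ → ℕ) (q : ℕ) (inj : ∀ j j′ → j < q → j′ < q → r j ≡ r j′ → j ≡ j′) where

  private
    hits≤1 : ∀ t n → n ≤ q → ∑[ j < n ] 𝟙 (r j ≡ᵇ t) ≤ 1
    hits≤1 t zero _ = z≤n
    hits≤1 t (suc n) n<q with r n ≟ t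
    ... | yes rn≡t = ≤-reflexive (cong₂ _+_ (sum-zero (λ j → 𝟙 (r j ≡ᵇ t)) n earlier-miss) (𝟙-≡ᵇ rn≡t))
      where
      earlier-miss : ∀ j → j < n → 𝟙 (r j ≡ᵇ t) ≡ 0
      earlier-miss j j<n = 𝟙-≢ᵇ λ rj≡t →
        <-irrefl (inj j n (<-trans j<n n<q) n<q (trans rj≡t (sym rn≡t))) j<n
    ... | no rn≢t = subst (_≤ 1) (sym (trans (cong (∑[ j < n ] 𝟙 (r j ≡ᵇ t) +_) (𝟙-≢ᵇ rn≢t)) (+-identityʳ _)))
                          (hits≤1 t n (<⇒≤ n<q))

    both-maximal : ∀ a b n → a ≤ n → b ≤ 1 → a + b ≡ suc n → a ≡ n × b ≡ 1
    both-maximal a 0 n a≤n _ a+0≡1+n = ⊥-elim (<-irrefl refl (subst (_≤ n) (trans (sym (+-identityʳ a)) a+0≡1+n) a≤n))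
    both-maximal a 1 n _ _ a+1≡1+n = +-cancelʳ-≡ 1 a n (trans a+1≡1+n (+-comm 1 n)) , refl
    both-maximal a (suc (suc _)) n _ (s≤s ()) _

    saturated : ∀ (c : ℕ → ℕ) n → (∀ t → c t ≤ 1) → ∑[ t < n ] c t ≡ n → ∀ t → t < n → c t ≡ 1
    saturated c (suc n) c≤1 total t t<1+n with both-maximal _ (c n) n (sum-≤ c n c≤1) (c≤1 n) total | t ≟ n
    ... | _ , cn≡1 | yes refl = cn≡1
    ... | rest≡n , _ | no t≢n = saturated c n c≤1 rest≡n t (≤∧≢⇒< (s≤s⁻¹ t<1+n) t≢n)

  -- Double counting: the hit counts are at most 1 and, summed over t < q, give q.
  sum-≡ᵇ-injective : (∀ j → r j < q) → ∀ t → t < q → ∑[ j < q ] 𝟙 (r j ≡ᵇ t) ≡ 1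
  sum-≡ᵇ-injective r<q = saturated (λ t → ∑[ j < q ] 𝟙 (r j ≡ᵇ t)) q (λ t → hits≤1 t q ≤-refl) (begin
    ∑[ t < q ] ∑[ j < q ] 𝟙 (r j ≡ᵇ t) ≡⟨ sum-swap _ q q ⟨
    ∑[ j < q ] ∑[ t < q ] 𝟙 (r j ≡ᵇ t) ≡⟨ sum-cong q (λ j _ → sum-≡ᵇ-present (r j) q (r<q j)) ⟩
    ∑[ j < q ] 1                       ≡⟨ trans (sum-const q 1) (*-identityʳ q) ⟩
    q                                  ∎)
    where open ≡-Reasoning

[m+n]%d≡m%d⇒d∣n : ∀ m n d .{{_ : NonZero d}} → (m + n) % d ≡ m % d → d ∣ n
[m+n]%d≡m%d⇒d∣n m n d eq =
  ∣m+n∣m⇒∣n (divides ((m + n) / d) (+-cancelˡ-≡ (m % d) _ _ expand)) (n∣m*n (m / d))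
  where
  open ≡-Reasoning
  expand : m % d + (m / d * d + n) ≡ m % d + (m + n) / d * d
  expand = begin
    m % d + (m / d * d + n)        ≡⟨ +-assoc (m % d) _ n ⟨
    m % d + m / d * d + n          ≡⟨ cong (_+ n) (m≡m%n+[m/n]*n m d) ⟨
    m + n                          ≡⟨ m≡m%n+[m/n]*n (m + n) d ⟩
    (m + n) % d + (m + n) / d * d  ≡⟨ cong (_+ (m + n) / d * d) eq ⟩
    m % d + (m + n) / d * d        ∎

module _ {q} (prime-q : Prime q) where
  private instance _ = prime⇒nonZero prime-q

  private
    ordered : ∀ {M} a → ¬ q ∣ M → ∀ {j j′} → j ≤ j′ → j′ < q
            → (a + j′ * M) % q ≡ (a + j * M) % q → j ≡ j′
    ordered {M} a q∤M {j} j≤j′ j′<q eq with m≤n⇒∃[o]m+o≡n j≤j′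
    ... | d , refl with euclidsLemma d M prime-q
                          ([m+n]%d≡m%d⇒d∣n (a + j * M) (d * M) q (trans (cong (_% q) (regroup a j d M)) eq))
      where
      regroup : ∀ a j d M → a + j * M + d * M ≡ a + (j + d) * M
      regroup = solve-∀
    ... | inj₂ q∣M = ⊥-elim (q∤M q∣M)
    ... | inj₁ q∣d with d
    ...   | zero = sym (+-identityʳ j)
    ...   | suc _ = ⊥-elim (>⇒∤ (≤-<-trans (m≤n+m _ j) j′<q) q∣d)

  progression-%-injective : ∀ {M} a → ¬ q ∣ M → ∀ {j j′} → j < q → j′ < q
                          → (a + j * M) % q ≡ (a + j′ * M) % q → j ≡ j′
  progression-%-injective a q∤M {j} {j′} j<q j′<q eq with ≤-total j j′
  ... | inj₁ j≤j′ = ordered a q∤M j≤j′ j′<q (sym eq)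
  ... | inj₂ j′≤j = sym (ordered a q∤M j′≤j j<q eq)

  sum-progression-%-≡ᵇ : ∀ {M} a → ¬ q ∣ M → ∀ t → t < q
                       → ∑[ j < q ] 𝟙 ((a + j * M) % q ≡ᵇ t) ≡ 1
  sum-progression-%-≡ᵇ {M} a q∤M = sum-≡ᵇ-injective (λ j → (a + j * M) % q) q
    (λ j j′ j<q j′<q → progression-%-injective a q∤M j<q j′<q) (λ j → m%n<n (a + j * M) q)

prime≢2⇒odd : ∀ {q} → Prime q → q ≢ 2 → q % 2 ≡ 1
prime≢2⇒odd {q} prime-q q≢2 with q % 2 in eq | m%n<n q 2
... | 0 | _ with prime⇒irreducible prime-q (m%n≡0⇒n∣m q 2 eq)
...   | inj₁ ()
...   | inj₂ 2≡q = ⊥-elim (q≢2 (sym 2≡q))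
prime≢2⇒odd prime-q q≢2 | 1 | _ = refl
prime≢2⇒odd prime-q q≢2 | suc (suc _) | s≤s (s≤s ())

even⊎odd : ∀ k → (∃ λ t → k ≡ t * 2) ⊎ (∃ λ t → k ≡ 1 + t * 2)
even⊎odd k with k % 2 | m%n<n k 2 | m≡m%n+[m/n]*n k 2
... | 0 | _ | k≡ = inj₁ (k / 2 , k≡)
... | 1 | _ | k≡ = inj₂ (k / 2 , k≡)
... | suc (suc _) | s≤s (s≤s ()) | _

shift≡even : ∀ q → shift q ≡ 2 * nearestSixth q * 2
shift≡even q = regroup (nearestSixth q)
  where
  regroup : ∀ x → 4 * x ≡ 2 * x * 2
  regroup = solve-∀

0<shift : ∀ {q} → 3 ≤ q → 0 < shift q
0<shift {q} 3≤q = ≤-trans (m≥n⇒m/n>0 {q + 3} {6} (+-monoˡ-≤ 3 3≤q)) (m≤n*m (nearestSixth q) 4)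

shift<q : ∀ {q} → 5 ≤ q → shift q < q
shift<q {q} 5≤q = ≰⇒> λ q≤4x → ≤⇒≯ (≤-trans q≤4x (4x≤4 (2x≤3 q≤4x))) 5≤q
  where
  x = nearestSixth q
  2x≤3 : q ≤ 4 * x → 2 * x ≤ 3
  2x≤3 q≤4x = +-cancelˡ-≤ (4 * x) (2 * x) 3 (begin
    4 * x + 2 * x ≡⟨ six x ⟩
    x * 6         ≤⟨ m/n*n≤m (q + 3) 6 ⟩
    q + 3         ≤⟨ +-monoˡ-≤ 3 q≤4x ⟩
    4 * x + 3     ∎)
    where
    open ≤-Reasoning
    six : ∀ x → 4 * x + 2 * x ≡ x * 6
    six = solve-∀
  4x≤4 : 2 * x ≤ 3 → 4 * x ≤ 4
  4x≤4 2x≤3 = *-monoʳ-≤ 4 (s≤s⁻¹ (*-cancelˡ-< 2 x 2 (s≤s 2x≤3)))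

shift≢q∸shift : ∀ {q} → q % 2 ≡ 1 → shift q ≤ q → shift q ≢ q ∸ shift q
shift≢q∸shift {q} q-odd s≤q s≡q∸s = 0≢1+n (trans (sym q-even) q-odd)
  where
  x = nearestSixth q
  q-even : q % 2 ≡ 0
  q-even = begin
    q % 2                      ≡⟨ cong (_% 2) (m∸n+n≡m s≤q) ⟨
    (q ∸ shift q + shift q) % 2 ≡⟨ cong (λ y → (y + shift q) % 2) s≡q∸s ⟨
    (shift q + shift q) % 2     ≡⟨ cong (_% 2) (double x) ⟩
    (4 * x * 2) % 2             ≡⟨ m*n%n≡0 (4 * x) 2 ⟩
    0                           ∎
    where
    open ≡-Reasoning
    double : ∀ x → 4 * x + 4 * x ≡ 4 * x * 2
    double = solve-∀

nonRankClass : (q : ℕ) .{{_ : NonZero q}} → ℕ → Bool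
nonRankClass q m = (m % q ≡ᵇ shift q) ∨ (m % q ≡ᵇ q ∸ shift q)

module _ {q} (prime-q : Prime q) (5≤q : 5 ≤ q) where
  private
    instance _ = prime⇒nonZero prime-q
    x = nearestSixth q
    s = shift q
    s<q = shift<q 5≤q
    q-odd = prime≢2⇒odd prime-q (λ { refl → ≤⇒≯ 5≤q (s≤s (s≤s (s≤s z≤n))) })
    s≤q = <⇒≤ s<q
    0<s = 0<shift (≤-trans (s≤s (s≤s (s≤s z≤n))) 5≤q)
    q∸s<q : q ∸ s < q
    q∸s<q = ∸-monoʳ-< 0<s s≤q

  nonRank⇒odd : ∀ {m} → NonRank q m → m % 2 ≡ 1
  nonRank⇒odd (inj₁ (n , refl)) =
    trans (cong (_% 2) (regroup n q x)) (trans (%-remove-+ˡ q (n∣m*n (n * q + 2 * x))) q-odd)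
    where
    regroup : ∀ n q x → (2 * n + 1) * q + 4 * x ≡ (n * q + 2 * x) * 2 + q
    regroup = solve-∀
  nonRank⇒odd {m} (inj₂ (n , _ , m+s≡)) = begin
    m % 2                    ≡⟨ [m+kn]%n≡m%n m (2 * x) 2 ⟨
    (m + 2 * x * 2) % 2      ≡⟨ cong (λ y → (m + y) % 2) (shift≡even q) ⟨
    (m + s) % 2              ≡⟨ cong (_% 2) (trans m+s≡ (regroup n q)) ⟩
    (n * q * 2 + q) % 2      ≡⟨ trans (%-remove-+ˡ q (n∣m*n (n * q))) q-odd ⟩
    1                        ∎
    where
    open ≡-Reasoning
    regroup : ∀ n q → (2 * n + 1) * q ≡ n * q * 2 + q
    regroup = solve-∀

  nonRank⇒class : ∀ {m} → NonRank q m → T (nonRankClass q m)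
  nonRank⇒class {m} (inj₁ (n , refl)) = Equivalence.from T-∨ (inj₁ (≡⇒≡ᵇ _ _ (begin
    ((2 * n + 1) * q + s) % q ≡⟨ cong (_% q) (+-comm ((2 * n + 1) * q) s) ⟩
    (s + (2 * n + 1) * q) % q ≡⟨ [m+kn]%n≡m%n s (2 * n + 1) q ⟩
    s % q                     ≡⟨ m<n⇒m%n≡m s<q ⟩
    s                         ∎)))
    where open ≡-Reasoning
  nonRank⇒class {m} (inj₂ (n , _ , m+s≡)) = Equivalence.from T-∨ (inj₂ (≡⇒≡ᵇ _ _ (begin
    m % q                     ≡⟨ cong (_% q) m≡ ⟩
    (q ∸ s + 2 * n * q) % q   ≡⟨ [m+kn]%n≡m%n (q ∸ s) (2 * n) q ⟩
    (q ∸ s) % q               ≡⟨ m<n⇒m%n≡m q∸s<q ⟩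
    q ∸ s                     ∎)))
    where
    open ≡-Reasoning
    m≡ : m ≡ q ∸ s + 2 * n * q
    m≡ = +-cancelʳ-≡ s m _ (begin
      m + s                       ≡⟨ m+s≡ ⟩
      (2 * n + 1) * q             ≡⟨ regroup n q ⟩
      2 * n * q + q               ≡⟨ cong (2 * n * q +_) (m∸n+n≡m s≤q) ⟨
      2 * n * q + (q ∸ s + s)     ≡⟨ +-assoc (2 * n * q) (q ∸ s) s ⟨
      2 * n * q + (q ∸ s) + s     ≡⟨ cong (_+ s) (+-comm (2 * n * q) (q ∸ s)) ⟩
      q ∸ s + 2 * n * q + s       ∎)
      where
      regroup : ∀ n q → (2 * n + 1) * q ≡ 2 * n * q + q
      regroup = solve-∀

  private
    quotient-form : ∀ {m r} → m % q ≡ r → m ≡ r + m / q * q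
    quotient-form {m} r≡ = trans (m≡m%n+[m/n]*n m q) (cong (_+ m / q * q) r≡)

    residue-shift⇒nonRank : ∀ {m} → m % 2 ≡ 1 → m % q ≡ s → NonRank q m
    residue-shift⇒nonRank {m} m-odd r≡s with even⊎odd (m / q)
    ... | inj₁ (t , k≡) = ⊥-elim (0≢1+n (trans (sym m-even) m-odd))
      where
      regroup : ∀ x t q → 2 * x * 2 + t * 2 * q ≡ (2 * x + t * q) * 2
      regroup = solve-∀
      m-even : m % 2 ≡ 0
      m-even = trans (cong (_% 2) (trans (quotient-form r≡s)
                 (trans (cong₂ (λ a k → a + k * q) (shift≡even q) k≡) (regroup x t q))))
                 (m*n%n≡0 (2 * x + t * q) 2)
    ... | inj₂ (t , k≡) = inj₁ (t , trans (quotient-form r≡s)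
                            (trans (cong (λ k → s + k * q) k≡) (regroup s t q)))
      where
      regroup : ∀ s t q → s + (1 + t * 2) * q ≡ (2 * t + 1) * q + s
      regroup = solve-∀

    q∸shift-form : ∀ {m} → m % q ≡ q ∸ s → m + s ≡ (1 + m / q) * q
    q∸shift-form {m} r≡q∸s = begin
      m + s                         ≡⟨ cong (_+ s) (quotient-form r≡q∸s) ⟩
      q ∸ s + m / q * q + s         ≡⟨ +-assoc (q ∸ s) _ s ⟩
      q ∸ s + (m / q * q + s)       ≡⟨ cong (q ∸ s +_) (+-comm _ s) ⟩
      q ∸ s + (s + m / q * q)       ≡⟨ +-assoc (q ∸ s) s _ ⟨
      q ∸ s + s + m / q * q         ≡⟨ cong (_+ m / q * q) (m∸n+n≡m s≤q) ⟩
      q + m / q * q                 ∎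
      where open ≡-Reasoning

    residue-q∸shift⇒nonRank : ∀ {m} → q ≤ m → m % 2 ≡ 1 → m % q ≡ q ∸ s → NonRank q m
    residue-q∸shift⇒nonRank {m} q≤m m-odd r≡q∸s with even⊎odd (m / q)
    ... | inj₁ (zero , k≡0) = ⊥-elim (≤⇒≯ q≤m (subst (m <_) m+s≡ (m<m+n m 0<s)))
      where
      m+s≡ : m + s ≡ q
      m+s≡ = trans (q∸shift-form r≡q∸s) (trans (cong (λ k → (1 + k) * q) k≡0) (+-identityʳ q))
    ... | inj₁ (suc t , k≡) =
      inj₂ (suc t , s≤s z≤n , trans (q∸shift-form r≡q∸s) (trans (cong (λ k → (1 + k) * q) k≡) (regroup t q)))
      where
      regroup : ∀ t q → (1 + suc t * 2) * q ≡ (2 * suc t + 1) * q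
      regroup = solve-∀
    ... | inj₂ (t , k≡) = ⊥-elim (0≢1+n (trans (sym m+s-even) m+s-odd))
      where
      regroup : ∀ t q → (1 + (1 + t * 2)) * q ≡ (1 + t) * q * 2
      regroup = solve-∀
      m+s-even : (m + s) % 2 ≡ 0
      m+s-even = trans (cong (_% 2) (trans (q∸shift-form r≡q∸s) (trans (cong (λ k → (1 + k) * q) k≡) (regroup t q))))
                   (m*n%n≡0 ((1 + t) * q) 2)
      m+s-odd : (m + s) % 2 ≡ 1
      m+s-odd = trans (cong (λ y → (m + y) % 2) (shift≡even q)) (trans ([m+kn]%n≡m%n m (2 * x) 2) m-odd)

  class⇒nonRank : ∀ {m} → q ≤ m → m % 2 ≡ 1 → T (nonRankClass q m) → NonRank q m
  class⇒nonRank {m} q≤m m-odd class with Equivalence.to T-∨ class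
  ... | inj₁ r≡s = residue-shift⇒nonRank m-odd (≡ᵇ⇒≡ _ _ r≡s)
  ... | inj₂ r≡q∸s = residue-q∸shift⇒nonRank q≤m m-odd (≡ᵇ⇒≡ _ _ r≡q∸s)

  sum-progression-class : ∀ {M} a → ¬ q ∣ M → ∑[ j < q ] 𝟙 (nonRankClass q (a + j * M)) ≡ 2
  sum-progression-class {M} a q∤M = begin
    ∑[ j < q ] 𝟙 (nonRankClass q (a + j * M))                 ≡⟨ sum-cong q (λ j _ → 𝟙-∨ _ _ (distinct (r j))) ⟩
    ∑[ j < q ] (𝟙 (r j ≡ᵇ s) + 𝟙 (r j ≡ᵇ q ∸ s))              ≡⟨ sum-+ q ⟩
    ∑[ j < q ] 𝟙 (r j ≡ᵇ s) + ∑[ j < q ] 𝟙 (r j ≡ᵇ q ∸ s)     ≡⟨ cong₂ _+_ (sum-progression-%-≡ᵇ prime-q a q∤M s s<q)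
                                                                   (sum-progression-%-≡ᵇ prime-q a q∤M (q ∸ s) q∸s<q) ⟩
    2                                                         ∎
    where
    open ≡-Reasoning
    r = λ j → (a + j * M) % q
    distinct : ∀ y → ¬ (T (y ≡ᵇ s) × T (y ≡ᵇ q ∸ s))
    distinct y (y≡s , y≡q∸s) = shift≢q∸shift q-odd s≤q (trans (sym (≡ᵇ⇒≡ y s y≡s)) (≡ᵇ⇒≡ y (q ∸ s) y≡q∸s))

  sum-progression-not-class : ∀ {M} a → ¬ q ∣ M → ∑[ j < q ] 𝟙 (not (nonRankClass q (a + j * M))) ≡ q ∸ 2
  sum-progression-not-class {M} a q∤M =
    trans (sum-not (λ j → nonRankClass q (a + j * M)) q) (cong (q ∸_) (sum-progression-class a q∤M))

nonRankClass-periodic : ∀ q .{{_ : NonZero q}} {X} → q ∣ X → Periodic X (nonRankClass q)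
nonRankClass-periodic q q∣X m = cong (λ r → (r ≡ᵇ shift q) ∨ (r ≡ᵇ q ∸ shift q)) (%-remove-+ʳ m q∣X)

isPrime≥5 : ℕ → Bool
isPrime≥5 n = does (prime? n ×-dec (5 ≤? n))

isPrime≥5⇒ : ∀ {n} → T (isPrime≥5 n) → Prime n × 5 ≤ n
isPrime≥5⇒ {n} = toWitness ∘ subst T (sym (isYes≗does (prime? n ×-dec (5 ≤? n))))

⇒isPrime≥5 : ∀ {n} → Prime n → 5 ≤ n → T (isPrime≥5 n)
⇒isPrime≥5 {n} prime-n 5≤n = subst T (isYes≗does (prime? n ×-dec (5 ≤? n))) (fromWitness (prime-n , 5≤n))

if-T : ∀ {A : Set} {b} {x y : A} → T b → (if b then x else y) ≡ x
if-T {b = true} _ = refl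

T-not⇒¬T : ∀ {b} → T (not b) → ¬ T b
T-not⇒¬T {true} ()

¬T⇒T-not : ∀ {b} → ¬ T b → T (not b)
¬T⇒T-not {true} ¬b = ¬b _
¬T⇒T-not {false} _ = _

L-positive : ∀ k → 0 < L k
L-positive zero = s≤s z≤n
L-positive (suc k) = *-mono-≤ (factor-positive (isPrime≥5 (suc k))) (L-positive k)
  where
  factor-positive : ∀ b → 0 < (if b then suc k else 1)
  factor-positive true = s≤s z≤n
  factor-positive false = s≤s z≤n

L-prime : ∀ k → T (isPrime≥5 (suc k)) → L (suc k) ≡ suc k * L k
L-prime k t = cong (_* L k) (if-T t)

∣L : ∀ {q} k → q ≤ k → T (isPrime≥5 q) → q ∣ L k
∣L zero z≤n ()
∣L {q} (suc k) q≤1+k t with q ≟ suc k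
... | yes refl = subst (suc k ∣_) (sym (L-prime k t)) (m∣m*n (L k))
... | no q≢1+k = ∣n⇒∣m*n (if isPrime≥5 (suc k) then suc k else 1) (∣L k (s≤s⁻¹ (≤∧≢⇒< q≤1+k q≢1+k)) t)

prime∤L : ∀ {q} k → Prime q → k < q → ¬ q ∣ L k
prime∤L zero prime-q _ q∣1 = ¬prime[1] (subst Prime (∣1⇒≡1 q∣1) prime-q)
prime∤L {q} (suc k) prime-q 1+k<q q∣L with euclidsLemma _ (L k) prime-q q∣L
... | inj₂ q∣Lk = prime∤L k prime-q (<-trans (n<1+n k) 1+k<q) q∣Lk
... | inj₁ q∣factor = ∤factor (isPrime≥5 (suc k)) q∣factor
  where
  ∤factor : ∀ b → ¬ q ∣ (if b then suc k else 1)
  ∤factor true = >⇒∤ 1+k<q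
  ∤factor false q∣1 = ¬prime[1] (subst Prime (∣1⇒≡1 q∣1) prime-q)

prime∤2L : ∀ {k} → Prime (suc k) → 5 ≤ suc k → ¬ suc k ∣ 2 * L k
prime∤2L {k} prime-p 5≤p p∣2L with euclidsLemma 2 (L k) prime-p p∣2L
... | inj₁ p∣2 = ≤⇒≯ (∣⇒≤ p∣2) (≤-trans (s≤s (s≤s (s≤s z≤n))) 5≤p)
... | inj₂ p∣L = prime∤L k prime-p (n<1+n k) p∣L

survives : ℕ → ℕ → Bool
survives zero m = m % 2 ≡ᵇ 1
survives (suc k) m = not (isPrime≥5 (suc k) ∧ nonRankClass (suc k) m) ∧ survives k m

survives-periodic : ∀ k {X} → 2 ∣ X → (∀ {q} → q ≤ k → T (isPrime≥5 q) → q ∣ X) → Periodic X (survives k)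
survives-periodic zero 2∣X _ m = cong (_≡ᵇ 1) (%-remove-+ʳ m 2∣X)
survives-periodic (suc k) 2∣X primes∣X m = cong₂ _∧_
  (gate (isPrime≥5 (suc k)) λ t → nonRankClass-periodic (suc k) (primes∣X ≤-refl t) m)
  (survives-periodic k 2∣X (λ q≤k → primes∣X (m≤n⇒m≤1+n q≤k)) m)
  where
  gate : ∀ b {x y} → (T b → x ≡ y) → not (b ∧ x) ≡ not (b ∧ y)
  gate true x≡y = cong not (x≡y _)
  gate false _ = refl

survives-periodic-2L : ∀ {k l} → k ≤ l → Periodic (2 * L l) (survives k)
survives-periodic-2L {k} {l} k≤l = survives-periodic k (m∣m*n (L l)) (λ q≤k t → ∣n⇒∣m*n 2 (∣L l (≤-trans q≤k k≤l) t))

survives-sound : ∀ k {m} → T (survives k m)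
               → m % 2 ≡ 1 × (∀ q → Prime q → 5 ≤ q → q ≤ k → ¬ NonRank q m)
survives-sound zero {m} odd = ≡ᵇ⇒≡ (m % 2) 1 odd , λ q _ 5≤q q≤0 _ → ≤⇒≯ q≤0 (≤-trans (s≤s z≤n) 5≤q)
survives-sound (suc k) {m} t with Equivalence.to T-∧ t
... | gate , rest with survives-sound k rest
...   | odd , below = odd , no-nonRank
  where
  no-nonRank : ∀ q → Prime q → 5 ≤ q → q ≤ suc k → ¬ NonRank q m
  no-nonRank q prime-q 5≤q q≤1+k nr with m≤n⇒m<n∨m≡n q≤1+k
  ... | inj₁ q<1+k = below q prime-q 5≤q (s≤s⁻¹ q<1+k) nr
  ... | inj₂ refl = T-not⇒¬T gate (Equivalence.from T-∧ (⇒isPrime≥5 prime-q 5≤q , nonRank⇒class prime-q 5≤q nr))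

survives-complete : ∀ k {m} → k ≤ m → m % 2 ≡ 1
                  → (∀ q → Prime q → 5 ≤ q → q ≤ k → ¬ NonRank q m) → T (survives k m)
survives-complete zero {m} _ odd _ = ≡⇒≡ᵇ (m % 2) 1 odd
survives-complete (suc k) {m} 1+k≤m odd below = Equivalence.from T-∧
  (¬T⇒T-not not-hit , survives-complete k (<⇒≤ 1+k≤m) odd (λ q pq 5≤q q≤k → below q pq 5≤q (m≤n⇒m≤1+n q≤k)))
  where
  not-hit : ¬ T (isPrime≥5 (suc k) ∧ nonRankClass (suc k) m)
  not-hit t with Equivalence.to T-∧ t
  ... | is-prime , class with isPrime≥5⇒ is-prime
  ...   | prime-p , 5≤p = below (suc k) prime-p 5≤p ≤-refl (class⇒nonRank prime-p 5≤p 1+k≤m odd class)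

-- Counts are over the window 1 ≤ m ≤ 2 L k, matching the counting convention of countParent.
sieve-refine-count : ∀ k (g : ℕ → Bool) c → (∀ a → ∑[ j < suc k ] 𝟙 (g (a + j * (2 * L k))) ≡ c)
             → ∑[ i < 2 * (suc k * L k) ] 𝟙 (g (suc i) ∧ survives k (suc i))
               ≡ c * ∑[ i < 2 * L k ] 𝟙 (survives k (suc i))
sieve-refine-count k g c count-g =
  trans (cong (λ n → ∑[ i < n ] 𝟙 (g (suc i) ∧ survives k (suc i))) (regroup 2 (suc k) (L k)))
        (sum-∧-periodic (g ∘ suc) (survives k ∘ suc) (suc k) (2 * L k) c
           (survives-periodic-2L {k} ≤-refl ∘ suc) (count-g ∘ suc))
  where
  regroup : ∀ a b c → a * (b * c) ≡ b * (a * c)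
  regroup = solve-∀

sieve-count : ∀ k → ∑[ i < 2 * L k ] 𝟙 (survives k (suc i)) ≡ primeProd (λ x → x ∸ 2) k
sieve-count zero = refl
sieve-count (suc k) = step (isPrime≥5 (suc k)) refl
  where
  step : ∀ b → isPrime≥5 (suc k) ≡ b
       → ∑[ i < 2 * ((if b then suc k else 1) * L k) ] 𝟙 (not (b ∧ nonRankClass (suc k) (suc i)) ∧ survives k (suc i))
         ≡ (if b then suc k ∸ 2 else 1) * primeProd (λ x → x ∸ 2) k
  step true is-prime with isPrime≥5⇒ (subst T (sym is-prime) _)
  ... | prime-p , 5≤p =
    trans (sieve-refine-count k (not ∘ nonRankClass (suc k)) (suc k ∸ 2)
             (λ a → sum-progression-not-class prime-p 5≤p a (prime∤2L prime-p 5≤p)))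
          (cong ((suc k ∸ 2) *_) (sieve-count k))
  step false _ =
    trans (cong (λ n → ∑[ i < 2 * n ] 𝟙 (survives k (suc i))) (*-identityˡ (L k)))
          (trans (sieve-count k) (sym (*-identityˡ _)))

parent-window-count : ∀ {k} → Prime (suc k) → 5 ≤ suc k
  → ∑[ i < 2 * L (suc k) ] 𝟙 (nonRankClass (suc k) (suc i) ∧ survives k (suc i)) ≡ 2 * G (suc k)
parent-window-count {k} prime-p 5≤p = begin
  ∑[ i < 2 * L (suc k) ] 𝟙 (nonRankClass (suc k) (suc i) ∧ survives k (suc i))
    ≡⟨ cong (λ n → ∑[ i < 2 * n ] 𝟙 (nonRankClass (suc k) (suc i) ∧ survives k (suc i)))
            (L-prime k (⇒isPrime≥5 prime-p 5≤p)) ⟩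
  ∑[ i < 2 * (suc k * L k) ] 𝟙 (nonRankClass (suc k) (suc i) ∧ survives k (suc i))
    ≡⟨ sieve-refine-count k (nonRankClass (suc k)) 2
         (λ a → sum-progression-class prime-p 5≤p a (prime∤2L prime-p 5≤p)) ⟩
  2 * ∑[ i < 2 * L k ] 𝟙 (survives k (suc i))
    ≡⟨ cong (2 *_) (sieve-count k) ⟩
  2 * G (suc k) ∎
  where open ≡-Reasoning

parent-indicator : ∀ {k m} → Prime (suc k) → 5 ≤ suc k → suc k ≤ m
                 → does (hasParent? (suc k) m) ≡ (nonRankClass (suc k) m ∧ survives k m)
parent-indicator {k} {m} prime-p 5≤p p≤m = does-⇔ (mk⇔ to from) (hasParent? (suc k) m) (T? _)
  where
  to : HasParent (suc k) m → T (nonRankClass (suc k) m ∧ survives k m)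
  to (nr , none-below) = Equivalence.from T-∧
    ( nonRank⇒class prime-p 5≤p nr
    , survives-complete k (<⇒≤ p≤m) (nonRank⇒odd prime-p 5≤p nr) (λ q pq 5≤q q≤k → none-below q pq 5≤q (s≤s q≤k)))
  from : T (nonRankClass (suc k) m ∧ survives k m) → HasParent (suc k) m
  from t with Equivalence.to T-∧ t
  ... | class , surv with survives-sound k surv
  ...   | odd , below = class⇒nonRank prime-p 5≤p p≤m odd class , λ q pq 5≤q q<p → below q pq 5≤q (s≤s⁻¹ q<p)

countParent-sum : ∀ p n → countParent p n ≡ ∑[ i < n ] 𝟙 (does (hasParent? p (suc i)))
countParent-sum p zero = refl
countParent-sum p (suc n) =
  trans (if-suc (does (hasParent? p (suc n)))) (cong (_+ 𝟙 (does (hasParent? p (suc n)))) (countParent-sum p n))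
  where
  if-suc : ∀ b {x} → (if b then suc x else x) ≡ x + 𝟙 b
  if-suc true = +-comm 1 _
  if-suc false = sym (+-identityʳ _)

-- The parent set agrees with a periodic set from p on; the factor 2 in the period 2 L(p) cancels.
parent-count-error : ∀ {k} → Prime (suc k) → 5 ≤ suc k → ∀ n
  → ∣ L (suc k) * countParent (suc k) n - G (suc k) * n ∣ ≤ L (suc k) * k + 2 * L (suc k) * (2 * L (suc k))
parent-count-error {k} prime-p 5≤p n = begin
  ∣ b * c - a * n ∣                   ≤⟨ ∣-∣-triangle (b * c) (b * Σ) (a * n) ⟩
  ∣ b * c - b * Σ ∣ + ∣ b * Σ - a * n ∣ ≤⟨ +-mono-≤ approximation (≤-trans (m≤n*m _ 2) periodic) ⟩
  b * k + P * P                       ∎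
  where
  open ≤-Reasoning
  p = suc k
  a = G p
  b = L p
  P = 2 * b
  B = λ i → 𝟙 (nonRankClass p (suc i) ∧ survives k (suc i))
  c = countParent p n
  Σ = ∑[ i < n ] B i
  instance _ = >-nonZero (≤-trans (s≤s z≤n) (*-monoʳ-≤ 2 (L-positive p)))
  approximation : ∣ b * c - b * Σ ∣ ≤ b * k
  approximation = begin
    ∣ b * c - b * Σ ∣ ≡⟨ *-distribˡ-∣-∣ b c Σ ⟨
    b * ∣ c - Σ ∣     ≡⟨ cong (λ x → b * ∣ x - Σ ∣) (countParent-sum p n) ⟩
    b * ∣ ∑[ i < n ] 𝟙 (does (hasParent? p (suc i))) - Σ ∣
                      ≤⟨ *-monoʳ-≤ b (sum-eventually-equal _ B k (λ i → 𝟙≤1 _) (λ i → 𝟙≤1 _)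
                           (λ i k≤i → cong 𝟙 (parent-indicator prime-p 5≤p (s≤s k≤i))) n) ⟩
    b * k             ∎
  periodic : 2 * ∣ b * Σ - a * n ∣ ≤ P * P
  periodic = begin
    2 * ∣ b * Σ - a * n ∣             ≡⟨ *-distribˡ-∣-∣ 2 (b * Σ) (a * n) ⟩
    ∣ 2 * (b * Σ) - 2 * (a * n) ∣     ≡⟨ cong₂ ∣_-_∣ (sym (*-assoc 2 b Σ)) (sym (*-assoc 2 a n)) ⟩
    ∣ P * Σ - 2 * a * n ∣             ≡⟨ cong (λ S → ∣ P * Σ - S * n ∣) (parent-window-count prime-p 5≤p) ⟨
    ∣ P * Σ - ∑[ i < P ] B i * n ∣    ≤⟨ periodic-sum-error P period (λ i → 𝟙≤1 _) n ⟩
    P * P                             ∎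
    where
    period : Periodic P B
    period i = cong 𝟙 (cong₂ _∧_
      (nonRankClass-periodic p (∣n⇒∣m*n 2 (∣L p ≤-refl (⇒isPrime≥5 prime-p 5≤p))) (suc i))
      (survives-periodic-2L (n≤1+n k) (suc i)))

proposition4p3 : ∀ (p : ℕ) → Prime p → 5 ≤ p
                   → HasNaturalDensity (countParent p) (G p) (L p)
proposition4p3 (suc k) prime-p 5≤p =
  bounded-error⇒density (countParent (suc k)) (G (suc k)) (L (suc k)) _ (L-positive (suc k))
    (parent-count-error prime-p 5≤p)
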